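{- Let $G,H$ be graphs, let $P_G$ be a pleat of $G$ and $P_H$ a pleat of $H$. Then $G$ and $H$ are homotopy equivalent if and only if $P_G$ and $P_H$ are isomorphic.
   Context: A graph is a finite undirected graph, loops allowed, at most one edge between two vertices; a graph morphism is a vertex map preserving edges. $N(u)$ is the set of vertices adjacent to $u$ ($u\in N(u)$ iff $u$ is looped). The exponential graph $H^G$ has as vertices the set maps $V(G)\to V(H)$, with $f\text{ --- }g$ iff $f(v_1)\text{ --- }g(v_2)$ for every edge $v_1\text{ --- }v_2$ of $G$ (loops included). Morphisms $f,g:G\to H$ are homotopic if there is a sequence of graph morphisms $f=f_0,\dots,f_n=g$ with $f_i\text{ --- }f_{i+1}$ in $H^G$. Graphs $G,H$ are homotopy equivalent if there are morphisms $f:G\to H$, $g:H\to G$ with $gf$ homotopic to $\mathrm{id}_G$ and $fg$ homotopic to $\mathrm{id}_H$. A graph is stiff if there are no two distinct vertices $v,w$ with $N(v)\subseteq N(w)$. A pleat of a graph $G$ is a stiff graph that is homotopy equivalent to $G$. -}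

module Defs where

open import Data.Nat using (ℕ)
open import Data.Fin using (Fin)
open import Data.Bool using (Bool; T)
open import Data.List using (List; []; _∷_)
open import Data.Product using (Σ; _×_; _,_)
open import Relation.Binary.PropositionalEquality using (_≡_)
open import Relation.Nullary using (¬_)

-- A finite undirected graph: vertex set Fin size, loops allowed,
-- at most one edge between two vertices (adjacency is a symmetric relation).
record Graph : Set where
  field
    size : ℕ
    adj  : Fin size → Fin size → Bool
    sym  : ∀ u v → adj u v ≡ adj v u

open Graph public

V : Graph → Set
V G = Fin (size G)

Edge : (G : Graph) → V G → V G → Set
Edge G u v = T (adj G u v)

IsMorphism : (G H : Graph) → (V G → V H) → Set
IsMorphism G H f = ∀ u v → Edge G u v → Edge H (f u) (f v)

Hom : Graph → Graph → Set
Hom G H = Σ (V G → V H) (IsMorphism G H)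

-- adjacency f --- g in the exponential graph H^G
ExpAdj : (G H : Graph) → (V G → V H) → (V G → V H) → Set
ExpAdj G H f g = ∀ v₁ v₂ → Edge G v₁ v₂ → Edge H (f v₁) (g v₂)

Chain : (G H : Graph) → (V G → V H) → List (Hom G H) → (V G → V H) → Set
Chain G H f [] g = ∀ x → f x ≡ g x
Chain G H f ((h , _) ∷ hs) g = ExpAdj G H f h × Chain G H h hs g

Homotopic : (G H : Graph) → (V G → V H) → (V G → V H) → Set
Homotopic G H f g = Σ (List (Hom G H)) (λ hs → Chain G H f hs g)

HomotopyEquivalent : Graph → Graph → Set
HomotopyEquivalent G H =
  Σ (Hom G H) λ { (f , _) → Σ (Hom H G) λ { (g , _) →
    Homotopic G G (λ x → g (f x)) (λ x → x) ×
    Homotopic H H (λ y → f (g y)) (λ y → y) } }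

NbhdSubset : (G : Graph) → V G → V G → Set
NbhdSubset G v w = ∀ u → Edge G u v → Edge G u w

Stiff : Graph → Set
Stiff G = ∀ v w → ¬ (v ≡ w) → ¬ NbhdSubset G v w

IsPleat : Graph → Graph → Set
IsPleat P G = Stiff P × HomotopyEquivalent G P

Isomorphic : Graph → Graph → Set
Isomorphic G H =
  Σ (V G → V H) λ f → Σ (V H → V G) λ g →
    (∀ x → g (f x) ≡ x) × (∀ y → f (g y) ≡ y) ×
    (∀ u v → Edge G u v → Edge H (f u) (f v)) ×
    (∀ u v → Edge H (f u) (f v) → Edge G u v)

module Submission where

-- The proof has two ingredients.
--  (1) Homotopy equivalence is an equivalence relation, and isomorphic
--      graphs are homotopy equivalent.  Transitivity rests on homotopy
--      being a congruence: chains of morphisms can be composed on both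
--      sides with fixed morphisms, and chains can be concatenated.
--  (2) Rigidity of stiff graphs: if an endomorphism f of a stiff graph P
--      is adjacent to the identity in P^P, then N(x) ⊆ N(f x) for every x,
--      so f x = x.  Walking back along a chain, every endomorphism
--      homotopic to the identity is the identity; hence a homotopy
--      equivalence between stiff graphs is an isomorphism.
-- For the theorem, G ≃ H gives PG ≃ G ≃ H ≃ PH, an equivalence of stiff
-- graphs and thus an isomorphism by (2); conversely an isomorphism
-- PG ≅ PH gives G ≃ PG ≃ PH ≃ H by (1).

open import Defs
open import Data.Product using (_×_; _,_; proj₁)
open import Data.List using (List; []; _∷_; map; _++_)
open import Data.Bool using (T)
open import Data.Fin using (_≟_)
open import Data.Empty using (⊥-elim)
open import Relation.Nullary using (yes; no)
open import Relation.Binary.PropositionalEquality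
  using (_≡_; refl; trans; cong; subst) renaming (sym to ≡-sym)

edge-sym : (G : Graph) {u v : V G} → Edge G u v → Edge G v u
edge-sym G {u} {v} = subst T (Graph.sym G u v)

edge-subst : (G : Graph) {u u′ v v′ : V G} → u ≡ u′ → v ≡ v′ →
  Edge G u v → Edge G u′ v′
edge-subst G refl refl e = e

-- Composition of graph morphisms (the graphs are explicit, since they
-- cannot be recovered from the type Hom G H, which unfolds to a Σ-type).
compose : (G H L : Graph) → Hom H L → Hom G H → Hom G L
compose G H L (b , mb) (a , ma) = (λ x → b (a x)) , λ u v e → mb _ _ (ma _ _ e)

whisker : (K G H L : Graph) → Hom H L → Hom K G → Hom G H → Hom K L
whisker K G H L b a h = compose K H L b (compose K G H h a)

chain-whisker : (K G H L : Graph) (b : Hom H L) (a : Hom K G) {f g : V G → V H} →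
  (hs : List (Hom G H)) → Chain G H f hs g →
  Chain K L (λ x → proj₁ b (f (proj₁ a x))) (map (whisker K G H L b a) hs)
    (λ x → proj₁ b (g (proj₁ a x)))
chain-whisker K G H L (b , _) (a , _) [] f≗g = λ x → cong b (f≗g (a x))
chain-whisker K G H L (b , mb) (a , ma) (_ ∷ hs) (f—h , c) =
  (λ v₁ v₂ e → mb _ _ (f—h _ _ (ma _ _ e))) , chain-whisker K G H L (b , mb) (a , ma) hs c

homotopic-whisker : (K G H L : Graph) (b : Hom H L) (a : Hom K G) {f g : V G → V H} →
  Homotopic G H f g →
  Homotopic K L (λ x → proj₁ b (f (proj₁ a x))) (λ x → proj₁ b (g (proj₁ a x)))
homotopic-whisker K G H L b a (hs , c) = map (whisker K G H L b a) hs , chain-whisker K G H L b a hs c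

chain-respects-start : {G H : Graph} {f f′ k : V G → V H} → (∀ x → f x ≡ f′ x) →
  (hs : List (Hom G H)) → Chain G H f′ hs k → Chain G H f hs k
chain-respects-start f≗f′ [] f′≗k = λ x → trans (f≗f′ x) (f′≗k x)
chain-respects-start {H = H} f≗f′ (_ ∷ hs) (f′—h , c) =
  (λ v₁ v₂ e → edge-subst H (≡-sym (f≗f′ v₁)) refl (f′—h v₁ v₂ e)) , c

chain-++ : {G H : Graph} {f g k : V G → V H} → (hs ks : List (Hom G H)) →
  Chain G H f hs g → Chain G H g ks k → Chain G H f (hs ++ ks) k
chain-++ [] ks f≗g d = chain-respects-start f≗g ks d
chain-++ (_ ∷ hs) ks (f—h , c) d = f—h , chain-++ hs ks c d

homotopic-trans : {G H : Graph} {f g k : V G → V H} →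
  Homotopic G H f g → Homotopic G H g k → Homotopic G H f k
homotopic-trans (hs , c) (ks , d) = hs ++ ks , chain-++ hs ks c d

≃-sym : {A B : Graph} → HomotopyEquivalent A B → HomotopyEquivalent B A
≃-sym (f , g , gf≃id , fg≃id) = g , f , fg≃id , gf≃id

-- With f = f₂f₁ and g = g₁g₂: gf = g₁(g₂f₂)f₁ ≃ g₁f₁ ≃ id, symmetrically for fg.
≃-trans : {A B C : Graph} → HomotopyEquivalent A B → HomotopyEquivalent B C →
  HomotopyEquivalent A C
≃-trans {A} {B} {C} (f₁ , g₁ , g₁f₁≃id , f₁g₁≃id) (f₂ , g₂ , g₂f₂≃id , f₂g₂≃id) =
  compose A B C f₂ f₁ , compose C B A g₁ g₂ ,
  homotopic-trans (homotopic-whisker A B B A g₁ f₁ g₂f₂≃id) g₁f₁≃id ,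
  homotopic-trans (homotopic-whisker C B B C f₂ g₂ f₁g₁≃id) f₂g₂≃id

iso⇒≃ : {A B : Graph} → Isomorphic A B → HomotopyEquivalent A B
iso⇒≃ {A} {B} (f , g , gf≡id , fg≡id , f-pres , f-refl) =
  (f , f-pres) , (g , g-pres) , ([] , gf≡id) , ([] , fg≡id)
  where
  g-pres : IsMorphism B A g
  g-pres u v e = f-refl _ _ (edge-subst B (≡-sym (fg≡id u)) (≡-sym (fg≡id v)) e)

-- If f is adjacent in P^P to a map pointwise equal to the identity,
-- then N(x) ⊆ N(f x): from u --- x we get x --- u, hence f x --- h u = u.
adjacent-to-id⇒nbhd-subset : (P : Graph) {f h : V P → V P} →
  ExpAdj P P f h → (∀ x → h x ≡ x) → ∀ x → NbhdSubset P x (f x)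
adjacent-to-id⇒nbhd-subset P f—h h≗id x u u—x =
  edge-sym P (edge-subst P refl (h≗id u) (f—h x u (edge-sym P u—x)))

stiff-nbhd-subset⇒id : (P : Graph) → Stiff P → {f : V P → V P} →
  (∀ x → NbhdSubset P x (f x)) → ∀ x → f x ≡ x
stiff-nbhd-subset⇒id P stiff {f} sub x with x ≟ f x
... | yes x≡fx = ≡-sym x≡fx
... | no  x≢fx = ⊥-elim (stiff x (f x) x≢fx (sub x))

stiff-chain⇒id : (P : Graph) → Stiff P → {f g : V P → V P} → (hs : List (Hom P P)) →
  Chain P P f hs g → (∀ x → g x ≡ x) → ∀ x → f x ≡ x
stiff-chain⇒id P stiff [] f≗g g≗id x = trans (f≗g x) (g≗id x)
stiff-chain⇒id P stiff (_ ∷ hs) (f—h , c) g≗id =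
  stiff-nbhd-subset⇒id P stiff
    (adjacent-to-id⇒nbhd-subset P f—h (stiff-chain⇒id P stiff hs c g≗id))

stiff-homotopic-id⇒id : (P : Graph) → Stiff P → {f : V P → V P} →
  Homotopic P P f (λ x → x) → ∀ x → f x ≡ x
stiff-homotopic-id⇒id P stiff (hs , c) = stiff-chain⇒id P stiff hs c (λ x → refl)

-- A homotopy equivalence between stiff graphs is an isomorphism: both
-- composites are the identity, and g reflects the edges f produces.
stiff-≃⇒iso : {A B : Graph} → Stiff A → Stiff B → HomotopyEquivalent A B → Isomorphic A B
stiff-≃⇒iso {A} {B} stiffA stiffB ((f , f-pres) , (g , g-pres) , gf≃id , fg≃id) =
  f , g , gf≡id , stiff-homotopic-id⇒id B stiffB fg≃id , f-pres , f-refl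
  where
  gf≡id : ∀ x → g (f x) ≡ x
  gf≡id = stiff-homotopic-id⇒id A stiffA gf≃id
  f-refl : ∀ u v → Edge B (f u) (f v) → Edge A u v
  f-refl u v e = edge-subst A (gf≡id u) (gf≡id v) (g-pres _ _ e)

theorem4p19 : (G H PG PH : Graph) → IsPleat PG G → IsPleat PH H →
    (HomotopyEquivalent G H → Isomorphic PG PH) × (Isomorphic PG PH → HomotopyEquivalent G H)
theorem4p19 G H PG PH (stiffPG , G≃PG) (stiffPH , H≃PH) =
  (λ G≃H → stiff-≃⇒iso stiffPG stiffPH (≃-trans (≃-sym G≃PG) (≃-trans G≃H H≃PH))) ,
  (λ PG≅PH → ≃-trans G≃PG (≃-trans (iso⇒≃ PG≅PH) (≃-sym H≃PH)))
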